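{- Let $S=(N,M_0)$ be a strongly connected H1S-WMG$_\le$ system with at least one place and one transition and incidence matrix $I$, such that deleting its shared place (if any) yields a strongly connected WMG$_\le$. Then $S$ is live if and only if there is no pair $(M,Y)$ with $M\in\mathbb{N}^P$, $Y\in\mathbb{N}^T$ and $M=M_0+I\cdot Y$ such that $M$ is a deadlock (enables no transition).
   Context: A Petri net is $N=(P,T,W)$ with finite disjoint sets $P$, $T$ and $W:(P\times T)\cup(T\times P)\to\mathbb{N}$; ${}^\bullet n=\{n':W(n',n)>0\}$, $n^\bullet=\{n':W(n,n')>0\}$. Incidence matrix: $I(p,t)=W(t,p)-W(p,t)$. Transition $t$ is enabled at marking $M$ if $M(p)\ge W(p,t)$ for all $p$; firing gives $M+I[\cdot,t]$. A system is live if for every transition $t$ and every reachable marking, some further reachable marking enables $t$. Strong connectedness refers to the bipartite directed graph with arcs $x\to y$ whenever $W(x,y)>0$. A place $p$ is shared if $|p^\bullet|\ge2$. $N$ is homogeneous if for each place $p$ all weights $W(p,t)$, $t\in p^\bullet$, are equal. H1S: homogeneous with at most one shared place. WMG$_\le$: each place has at most one input and at most one output transition. Deleting a place removes it and its adjacent arcs, keeping all transitions. H1S-WMG$_\le$: an H1S net such that deleting its shared place (if any) yields a WMG$_\le$. -}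

module Defs where

open import Data.Nat using (ℕ; zero; suc; _+_; _∸_; _≤_; _<_)
open import Data.Integer as ℤ using (ℤ; +_)
open import Data.Fin using (Fin)
import Data.Fin as Fin
open import Data.Sum using (_⊎_; inj₁; inj₂)
open import Data.Product using (Σ; ∃; _×_; _,_)
open import Data.Empty using (⊥)
open import Data.Unit using (⊤)
open import Relation.Nullary using (¬_)
open import Relation.Binary.PropositionalEquality using (_≡_)
open import Relation.Binary.Construct.Closure.ReflexiveTransitive using (Star)

-- A Petri net with places Fin np and transitions Fin nt.
-- pre p t = W(p,t), post t p = W(t,p).
record Net : Set where
  field
    np   : ℕ
    nt   : ℕ
    pre  : Fin np → Fin nt → ℕ
    post : Fin nt → Fin np → ℕ
open Net public

Marking : Net → Set
Marking N = Fin (np N) → ℕ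

incidence : (N : Net) → Fin (np N) → Fin (nt N) → ℤ
incidence N p t = (+ post N t p) ℤ.- (+ pre N p t)

sumFin : (n : ℕ) → (Fin n → ℤ) → ℤ
sumFin zero    f = + 0
sumFin (suc n) f = f Fin.zero ℤ.+ sumFin n (λ i → f (Fin.suc i))

IY : (N : Net) → (Fin (nt N) → ℕ) → Fin (np N) → ℤ
IY N Y p = sumFin (nt N) (λ t → incidence N p t ℤ.* (+ Y t))

Enabled : (N : Net) → Marking N → Fin (nt N) → Set
Enabled N M t = ∀ p → pre N p t ≤ M p

Step : (N : Net) → Marking N → Marking N → Set
Step N M M' = Σ (Fin (nt N)) λ t →
  Enabled N M t × (∀ p → M' p ≡ (M p ∸ pre N p t) + post N t p)

Reach : (N : Net) → Marking N → Marking N → Set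
Reach N = Star (Step N)

Live : (N : Net) → Marking N → Set
Live N M0 = ∀ (t : Fin (nt N)) (M : Marking N) → Reach N M0 M →
  Σ (Marking N) λ M' → Reach N M M' × Enabled N M' t

Deadlock : (N : Net) → Marking N → Set
Deadlock N M = ∀ t → ¬ Enabled N M t

Node : Net → Set
Node N = Fin (np N) ⊎ Fin (nt N)

Arc : (N : Net) → Node N → Node N → Set
Arc N (inj₁ p) (inj₂ t) = 0 < pre N p t
Arc N (inj₂ t) (inj₁ p) = 0 < post N t p
Arc N (inj₁ _) (inj₁ _) = ⊥
Arc N (inj₂ _) (inj₂ _) = ⊥

ArcIn : (N : Net) → (Node N → Set) → Node N → Node N → Set
ArcIn N keep x y = keep x × keep y × Arc N x y

StronglyConnectedOn : (N : Net) → (Node N → Set) → Set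
StronglyConnectedOn N keep = ∀ x y → keep x → keep y → Star (ArcIn N keep) x y


StronglyConnected : Net → Set
StronglyConnected N = ∀ (x y : Node N) → Star (Arc N) x y

Shared : (N : Net) → Fin (np N) → Set
Shared N p = Σ (Fin (nt N)) λ t → Σ (Fin (nt N)) λ t' →
  ¬ (t ≡ t') × 0 < pre N p t × 0 < pre N p t'

Homogeneous : Net → Set
Homogeneous N = ∀ p t t' → 0 < pre N p t → 0 < pre N p t' → pre N p t ≡ pre N p t'

AtMostOneShared : Net → Set
AtMostOneShared N = ∀ p q → Shared N p → Shared N q → p ≡ q

H1S : Net → Set
H1S N = Homogeneous N × AtMostOneShared N

KeptAfterDeletion : (N : Net) → Node N → Set
KeptAfterDeletion N (inj₁ p) = ¬ Shared N p
KeptAfterDeletion N (inj₂ t) = ⊤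

WMG≤AfterDeletion : Net → Set
WMG≤AfterDeletion N = ∀ p → ¬ Shared N p →
  (∀ t t' → 0 < post N t p → 0 < post N t' p → t ≡ t') ×
  (∀ t t' → 0 < pre N p t → 0 < pre N p t' → t ≡ t')

H1S-WMG≤ : Net → Set
H1S-WMG≤ N = H1S N × WMG≤AfterDeletion N

StronglyConnectedAfterDeletion : Net → Set
StronglyConnectedAfterDeletion N = StronglyConnectedOn N (KeptAfterDeletion N)

DeadlockSolution : (N : Net) → Marking N → Set
DeadlockSolution N M0 = Σ (Marking N) λ M → Σ (Fin (nt N) → ℕ) λ Y →
  (∀ p → + M p ≡ + M0 p ℤ.+ IY N Y p) × Deadlock N M

-- Live ⇒ no deadlock solution: starting from M0, fire transitions of the support of Y
-- while possible, shrinking Y. At the stuck reachable marking M' some transition y ∉ supp Y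
-- is enabled, since M' is not dead. A shared place blocking some u ∈ supp Y would, by
-- homogeneity, block y as well; so each u ∈ supp Y is blocked by a non-shared place whose
-- unique input lies in supp Y. These places never gain tokens, so liveness forces Y = 0,
-- i.e. M' ≤ M, and y is enabled at the deadlock M.
--
-- No deadlock solution ⇒ live: in the strongly connected WMG≤ left after deleting the
-- shared place, the state equation bounds the firings of every transition along arcs,
-- starting from a transition t that does not fire. Hence, from any reachable marking,
-- firing arbitrary transitions either enables t or reaches a deadlock, whose firing
-- count would be a deadlock solution.

module Submission where

open import Defs
open import Data.Nat using (_≥_)
open import Data.Product using (_×_)
open import Relation.Nullary using (¬_)
open import Function.Bundles using (_⇔_; mk⇔; Equivalence)

open import Data.Nat as ℕ using (ℕ; zero; suc; _+_; _*_; _∸_; _≤_; _<_; z≤n; z<s; s≤s⁻¹; >-nonZero)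
open import Data.Nat.Properties
open import Data.Nat.Tactic.RingSolver as ℕ-Solver using ()
open import Data.Integer as ℤ using (+_)
import Data.Integer.Properties as ℤ
open import Data.Integer.Tactic.RingSolver as ℤ-Solver using ()
open import Data.Fin as Fin using (Fin)
import Data.Fin.Properties as Fin
open import Data.Product using (∃; _,_; proj₁; proj₂)
open import Data.Sum using (inj₁; inj₂)
open import Data.Empty using (⊥; ⊥-elim)
open import Data.Unit using (tt)
open import Relation.Nullary using (yes; no; Dec; contradiction)
open import Relation.Nullary.Decidable using (_×-dec_)
open import Relation.Binary.PropositionalEquality
open import Relation.Binary.Construct.Closure.ReflexiveTransitive using (Star; ε; _◅_; _◅◅_)
open import Algebra.Properties.Semiring.Sum +-*-semiring using (sum; sum-cong-≗; ∑-distrib-+; sum-replicate-zero)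
open import Function using (id; _∘_)
open import Algebra.Properties.CommutativeSemigroup +-commutativeSemigroup using (x∙yz≈xz∙y; xy∙z≈xz∙y)

δ : ∀ {n} → Fin n → Fin n → ℕ
δ Fin.zero    Fin.zero    = 1
δ Fin.zero    (Fin.suc _) = 0
δ (Fin.suc _) Fin.zero    = 0
δ (Fin.suc x) (Fin.suc y) = δ x y

δ-≢ : ∀ {n} {x y : Fin n} → x ≢ y → δ x y ≡ 0
δ-≢ {x = Fin.zero}  {Fin.zero}  x≢y = contradiction refl x≢y
δ-≢ {x = Fin.zero}  {Fin.suc _} _   = refl
δ-≢ {x = Fin.suc _} {Fin.zero}  _   = refl
δ-≢ {x = Fin.suc x} {Fin.suc y} x≢y = δ-≢ (x≢y ∘ cong Fin.suc)

δ-refl : ∀ {n} (x : Fin n) → δ x x ≡ 1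
δ-refl Fin.zero    = refl
δ-refl (Fin.suc x) = δ-refl x

δ-split : ∀ {n} (Y : Fin n → ℕ) u → 0 < Y u → ∀ t → Y t ≡ δ u t + (Y t ∸ δ u t)
δ-split Y u 0<Yu t = sym (m+[n∸m]≡n δ≤Y)
  where
  δ≤Y : δ u t ≤ Y t
  δ≤Y with u Fin.≟ t
  ... | yes refl rewrite δ-refl u = 0<Yu
  ... | no u≢t   rewrite δ-≢ u≢t  = z≤n

sum-cong : ∀ {n} {f g : Fin n → ℕ} → (∀ t → f t ≡ g t) → sum f ≡ sum g
sum-cong = sum-cong-≗

sum-zero : ∀ {n} {f : Fin n → ℕ} → (∀ t → f t ≡ 0) → sum f ≡ 0
sum-zero {n} f≗0 = trans (sum-cong f≗0) (sum-replicate-zero n)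

sum-mono-≤ : ∀ {n} {f g : Fin n → ℕ} → (∀ t → f t ≤ g t) → sum f ≤ sum g
sum-mono-≤ {zero}  f≤g = z≤n
sum-mono-≤ {suc n} f≤g = +-mono-≤ (f≤g Fin.zero) (sum-mono-≤ (f≤g ∘ Fin.suc))

dot : ∀ {n} → (Fin n → ℕ) → (Fin n → ℕ) → ℕ
dot f Y = sum (λ t → f t * Y t)

dot-congʳ : ∀ {n} (f : Fin n → ℕ) {Y Z : Fin n → ℕ} → (∀ t → Y t ≡ Z t) → dot f Y ≡ dot f Z
dot-congʳ f Y≗Z = sum-cong (λ t → cong (f t *_) (Y≗Z t))

dot-distribʳ-+ : ∀ {n} (f Y Z : Fin n → ℕ) → dot f (λ t → Y t + Z t) ≡ dot f Y + dot f Z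
dot-distribʳ-+ f Y Z = trans (sum-cong (λ t → *-distribˡ-+ (f t) (Y t) (Z t)))
                             (∑-distrib-+ (λ t → f t * Y t) (λ t → f t * Z t))

dot-zeroʳ : ∀ {n} (f : Fin n → ℕ) → dot f (λ _ → 0) ≡ 0
dot-zeroʳ f = sum-zero (*-zeroʳ ∘ f)

dot-δ : ∀ {n} (f : Fin n → ℕ) (x : Fin n) → dot f (δ x) ≡ f x
dot-δ {suc n} f Fin.zero = begin
  f Fin.zero * 1 + sum (λ i → f (Fin.suc i) * 0)
    ≡⟨ cong₂ _+_ (*-identityʳ _) (sum-zero (*-zeroʳ ∘ f ∘ Fin.suc)) ⟩
  f Fin.zero + 0
    ≡⟨ +-identityʳ _ ⟩
  f Fin.zero
    ∎
  where open ≡-Reasoning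
dot-δ {suc n} f (Fin.suc x) = cong₂ _+_ (*-zeroʳ (f Fin.zero)) (dot-δ (f ∘ Fin.suc) x)

sum-δ : ∀ {n} (x : Fin n) → sum (δ x) ≡ 1
sum-δ x = trans (sum-cong (sym ∘ *-identityˡ ∘ δ x)) (dot-δ (λ _ → 1) x)

sum-δ-split : ∀ {n} (Y : Fin n → ℕ) u → 0 < Y u → sum Y ≡ suc (sum (λ t → Y t ∸ δ u t))
sum-δ-split Y u 0<Yu = begin
  sum Y                                          ≡⟨ sum-cong (δ-split Y u 0<Yu) ⟩
  sum (λ t → δ u t + (Y t ∸ δ u t))              ≡⟨ ∑-distrib-+ (δ u) (λ t → Y t ∸ δ u t) ⟩
  sum (δ u) + sum (λ t → Y t ∸ δ u t)            ≡⟨ cong (_+ sum (λ t → Y t ∸ δ u t)) (sum-δ u) ⟩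
  suc (sum (λ t → Y t ∸ δ u t))                  ∎
  where open ≡-Reasoning

dot-vanish : ∀ {n} {f Y : Fin n → ℕ} → (∀ t → 0 < f t → Y t ≡ 0) → dot f Y ≡ 0
dot-vanish {f = f} {Y} supp = sum-zero term
  where
  term : ∀ t → f t * Y t ≡ 0
  term t with f t in ft≡
  ... | zero  = refl
  ... | suc k = trans (cong (suc k *_) (supp t (subst (0 <_) (sym ft≡) z<s))) (*-zeroʳ (suc k))

dot-single : ∀ {n} {f : Fin n → ℕ} (Y : Fin n → ℕ) {v} → (∀ t → 0 < f t → t ≡ v) → dot f Y ≡ f v * Y v
dot-single {f = f} Y {v} supp = trans (sum-cong term) (dot-δ (λ _ → f v * Y v) v)
  where
  term : ∀ t → f t * Y t ≡ f v * Y v * δ v t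
  term t with v Fin.≟ t
  ... | yes refl = sym (trans (cong (f v * Y v *_) (δ-refl v)) (*-identityʳ _))
  ... | no v≢t rewrite δ-≢ v≢t with f t in ft≡
  ...   | zero  = sym (*-zeroʳ (f v * Y v))
  ...   | suc _ = contradiction (sym (supp t (subst (0 <_) (sym ft≡) z<s))) v≢t

term≤dot : ∀ {n} (f Y : Fin n → ℕ) u → f u * Y u ≤ dot f Y
term≤dot f Y Fin.zero    = m≤m+n _ _
term≤dot f Y (Fin.suc u) = ≤-trans (term≤dot (f ∘ Fin.suc) (Y ∘ Fin.suc) u) (m≤n+m _ _)

sumFin-dot : ∀ n (a b Y : Fin n → ℕ) →
             sumFin n (λ t → (+ a t ℤ.- + b t) ℤ.* + Y t) ≡ + dot a Y ℤ.- + dot b Y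
sumFin-dot zero    a b Y = refl
sumFin-dot (suc n) a b Y = begin
  (+ a₀ ℤ.- + b₀) ℤ.* + y₀ ℤ.+ sumFin n _
    ≡⟨ cong (ℤ._+_ ((+ a₀ ℤ.- + b₀) ℤ.* + y₀)) (sumFin-dot n (a ∘ Fin.suc) (b ∘ Fin.suc) (Y ∘ Fin.suc)) ⟩
  (+ a₀ ℤ.- + b₀) ℤ.* + y₀ ℤ.+ (+ A ℤ.- + B)
    ≡⟨ distribute (+ a₀) (+ b₀) (+ y₀) (+ A) (+ B) ⟩
  (+ a₀ ℤ.* + y₀ ℤ.+ + A) ℤ.- (+ b₀ ℤ.* + y₀ ℤ.+ + B)
    ≡⟨ cong₂ ℤ._-_ (embed a₀ A) (embed b₀ B) ⟩
  + (a₀ * y₀ + A) ℤ.- + (b₀ * y₀ + B)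
    ∎
  where
  open ≡-Reasoning
  a₀ = a Fin.zero ; b₀ = b Fin.zero ; y₀ = Y Fin.zero
  A = dot (a ∘ Fin.suc) (Y ∘ Fin.suc) ; B = dot (b ∘ Fin.suc) (Y ∘ Fin.suc)
  distribute : ∀ a b y A B → (a ℤ.- b) ℤ.* y ℤ.+ (A ℤ.- B) ≡ (a ℤ.* y ℤ.+ A) ℤ.- (b ℤ.* y ℤ.+ B)
  distribute = ℤ-Solver.solve-∀
  embed : ∀ c C → + c ℤ.* + y₀ ℤ.+ + C ≡ + (c * y₀ + C)
  embed c C = trans (cong (ℤ._+ + C) (sym (ℤ.pos-* c y₀))) (sym (ℤ.pos-+ (c * y₀) C))

ℕ-balance⇔ℤ-difference : ∀ m m' a b → (m' + b ≡ m + a) ⇔ (+ m' ≡ + m ℤ.+ (+ a ℤ.- + b))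
ℕ-balance⇔ℤ-difference m m' a b = mk⇔ to from
  where
  open ≡-Reasoning
  to : m' + b ≡ m + a → + m' ≡ + m ℤ.+ (+ a ℤ.- + b)
  to balance = begin
    + m'                          ≡⟨ add-sub (+ m') (+ b) ⟩
    (+ m' ℤ.+ + b) ℤ.- + b        ≡⟨ cong (ℤ._- + b) (ℤ.pos-+ m' b) ⟨
    + (m' + b) ℤ.- + b            ≡⟨ cong (λ k → + k ℤ.- + b) balance ⟩
    + (m + a) ℤ.- + b             ≡⟨ cong (ℤ._- + b) (ℤ.pos-+ m a) ⟩
    (+ m ℤ.+ + a) ℤ.- + b         ≡⟨ ℤ.+-assoc (+ m) (+ a) (ℤ.- + b) ⟩
    + m ℤ.+ (+ a ℤ.- + b)         ∎
    where
    add-sub : ∀ x y → x ≡ (x ℤ.+ y) ℤ.- y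
    add-sub = ℤ-Solver.solve-∀
  from : + m' ≡ + m ℤ.+ (+ a ℤ.- + b) → m' + b ≡ m + a
  from difference = ℤ.+-injective (begin
    + (m' + b)                              ≡⟨ ℤ.pos-+ m' b ⟩
    + m' ℤ.+ + b                            ≡⟨ cong (ℤ._+ + b) difference ⟩
    (+ m ℤ.+ (+ a ℤ.- + b)) ℤ.+ + b         ≡⟨ sub-add (+ m) (+ a) (+ b) ⟩
    + m ℤ.+ + a                             ≡⟨ ℤ.pos-+ m a ⟨
    + (m + a)                               ∎)
    where
    sub-add : ∀ x y z → (x ℤ.+ (y ℤ.- z)) ℤ.+ z ≡ x ℤ.+ y
    sub-add = ℤ-Solver.solve-∀

consumed : (N : Net) → (Fin (nt N) → ℕ) → Fin (np N) → ℕ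
consumed N Y p = dot (pre N p) Y

produced : (N : Net) → (Fin (nt N) → ℕ) → Fin (np N) → ℕ
produced N Y p = dot (λ t → post N t p) Y

StateEq : (N : Net) → Marking N → (Fin (nt N) → ℕ) → Marking N → Set
StateEq N M Y M' = ∀ p → M' p + consumed N Y p ≡ M p + produced N Y p

module _ {N : Net} where

  stateEq-refl : ∀ {M} → StateEq N M (λ _ → 0) M
  stateEq-refl {M} p = cong (_+_ (M p)) (trans (dot-zeroʳ (pre N p)) (sym (dot-zeroʳ (λ t → post N t p))))

  stateEq-step : ∀ {M M'} (st : Step N M M') → StateEq N M (δ (proj₁ st)) M'
  stateEq-step {M} {M'} (x , en , fired) p = begin
    M' p + dot (pre N p) (δ x)                  ≡⟨ cong₂ _+_ (fired p) (dot-δ (pre N p) x) ⟩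
    M p ∸ pre N p x + post N x p + pre N p x    ≡⟨ xy∙z≈xz∙y (M p ∸ pre N p x) _ _ ⟩
    M p ∸ pre N p x + pre N p x + post N x p    ≡⟨ cong (_+ post N x p) (m∸n+n≡m (en p)) ⟩
    M p + post N x p                            ≡⟨ cong (_+_ (M p)) (dot-δ (λ t → post N t p) x) ⟨
    M p + dot (λ t → post N t p) (δ x)          ∎
    where open ≡-Reasoning

  stateEq-congʳ : ∀ {M M' Y Z} → (∀ t → Y t ≡ Z t) → StateEq N M Y M' → StateEq N M Z M'
  stateEq-congʳ {M} {M'} Y≗Z eq p =
    trans (cong (_+_ (M' p)) (sym (dot-congʳ (pre N p) Y≗Z)))
          (trans (eq p) (cong (_+_ (M p)) (dot-congʳ (λ t → post N t p) Y≗Z)))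

  stateEq-trans : ∀ {M M' M'' Y Z} → StateEq N M Y M' → StateEq N M' Z M'' →
                  StateEq N M (λ t → Y t + Z t) M''
  stateEq-trans {M} {M'} {M''} {Y} {Z} eqY eqZ p = begin
    M'' p + consumed N (λ t → Y t + Z t) p  ≡⟨ cong (_+_ (M'' p)) (dot-distribʳ-+ (pre N p) Y Z) ⟩
    M'' p + (cY + cZ)                       ≡⟨ x∙yz≈xz∙y (M'' p) cY cZ ⟩
    (M'' p + cZ) + cY                       ≡⟨ cong (_+ cY) (eqZ p) ⟩
    (M' p + pZ) + cY                        ≡⟨ xy∙z≈xz∙y (M' p) pZ cY ⟩
    (M' p + cY) + pZ                        ≡⟨ cong (_+ pZ) (eqY p) ⟩
    (M p + pY) + pZ                         ≡⟨ +-assoc (M p) pY pZ ⟩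
    M p + (pY + pZ)                         ≡⟨ cong (_+_ (M p)) (dot-distribʳ-+ (λ t → post N t p) Y Z) ⟨
    M p + produced N (λ t → Y t + Z t) p    ∎
    where
    open ≡-Reasoning
    cY = consumed N Y p ; cZ = consumed N Z p ; pY = produced N Y p ; pZ = produced N Z p

  stateEq-cancelˡ : ∀ {M M' M'' Y Z} → StateEq N M Y M' → StateEq N M (λ t → Y t + Z t) M'' →
                    StateEq N M' Z M''
  stateEq-cancelˡ {M} {M'} {M''} {Y} {Z} eqY eqYZ p = +-cancelˡ-≡ (M' p + cY) _ _ (begin
    (M' p + cY) + (M'' p + cZ)  ≡⟨ shuffleˡ (M' p) cY (M'' p) cZ ⟩
    M' p + (M'' p + (cY + cZ))  ≡⟨ cong (_+_ (M' p)) eqYZ′ ⟩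
    M' p + (M p + (pY + pZ))    ≡⟨ shuffleʳ (M p) pY (M' p) pZ ⟨
    (M p + pY) + (M' p + pZ)    ≡⟨ cong (_+ (M' p + pZ)) (eqY p) ⟨
    (M' p + cY) + (M' p + pZ)   ∎)
    where
    open ≡-Reasoning
    cY = consumed N Y p ; cZ = consumed N Z p ; pY = produced N Y p ; pZ = produced N Z p
    eqYZ′ : M'' p + (cY + cZ) ≡ M p + (pY + pZ)
    eqYZ′ = subst₂ (λ c d → M'' p + c ≡ M p + d)
              (dot-distribʳ-+ (pre N p) Y Z) (dot-distribʳ-+ (λ t → post N t p) Y Z) (eqYZ p)
    shuffleˡ : ∀ a b c d → (a + b) + (c + d) ≡ a + (c + (b + d))
    shuffleˡ = ℕ-Solver.solve-∀
    shuffleʳ : ∀ a b c d → (a + b) + (c + d) ≡ c + (a + (b + d))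
    shuffleʳ = ℕ-Solver.solve-∀

  stateEq-reach : ∀ {M M'} → Reach N M M' → ∃ λ Y → StateEq N M Y M'
  stateEq-reach ε            = _ , stateEq-refl
  stateEq-reach (st ◅ steps) = _ , stateEq-trans (stateEq-step st) (proj₂ (stateEq-reach steps))

  stateEq-unconsumed⇒≤ : ∀ {M M' Y q} → StateEq N M Y M' → consumed N Y q ≡ 0 → M q ≤ M' q
  stateEq-unconsumed⇒≤ {M} {M'} {Y} {q} eq unconsumed = begin
    M q                        ≤⟨ m≤m+n (M q) _ ⟩
    M q + produced N Y q       ≡⟨ eq q ⟨
    M' q + consumed N Y q      ≡⟨ cong (_+_ (M' q)) unconsumed ⟩
    M' q + 0                   ≡⟨ +-identityʳ (M' q) ⟩
    M' q                       ∎
    where open ≤-Reasoning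

  stateEq-unproduced⇒consumed≤ : ∀ {M M' Y q} → StateEq N M Y M' → produced N Y q ≡ 0 →
                                 consumed N Y q ≤ M q
  stateEq-unproduced⇒consumed≤ {M} {M'} {Y} {q} eq unproduced = begin
    consumed N Y q             ≤⟨ m≤n+m _ (M' q) ⟩
    M' q + consumed N Y q      ≡⟨ eq q ⟩
    M q + produced N Y q       ≡⟨ cong (_+_ (M q)) unproduced ⟩
    M q + 0                    ≡⟨ +-identityʳ (M q) ⟩
    M q                        ∎
    where open ≤-Reasoning

  stateEq⇔incidence : ∀ {M M'} (Y : Fin (nt N) → ℕ) →
                      StateEq N M Y M' ⇔ (∀ p → + M' p ≡ + M p ℤ.+ IY N Y p)
  stateEq⇔incidence {M} {M'} Y = mk⇔
    (λ eq p → subst (λ d → + M' p ≡ + M p ℤ.+ d) (sym (IY-dot p))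
                    (Equivalence.to (balance p) (eq p)))
    (λ eq p → Equivalence.from (balance p)
                    (subst (λ d → + M' p ≡ + M p ℤ.+ d) (IY-dot p) (eq p)))
    where
    balance : ∀ p → _ ⇔ _
    balance p = ℕ-balance⇔ℤ-difference (M p) (M' p) (produced N Y p) (consumed N Y p)
    IY-dot : ∀ p → IY N Y p ≡ + produced N Y p ℤ.- + consumed N Y p
    IY-dot p = sumFin-dot (nt N) (λ t → post N t p) (pre N p) Y

  enabled? : ∀ M t → Dec (Enabled N M t)
  enabled? M t = Fin.all? (λ p → pre N p t ℕ.≤? M p)

  fire : Marking N → Fin (nt N) → Marking N
  fire M t p = (M p ∸ pre N p t) + post N t p

  fire-step : ∀ {M t} → Enabled N M t → Step N M (fire M t)
  fire-step {t = t} en = t , en , λ _ → refl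

  disablingPlace : ∀ {M t} → ¬ Enabled N M t → ∃ λ q → M q < pre N q t
  disablingPlace {M} {t} ¬en with Fin.¬∀⟶∃¬ (np N) _ (λ p → pre N p t ℕ.≤? M p) ¬en
  ... | q , short = q , ≰⇒> short

  live⇒deadlock-free : ∀ {M0 M} → nt N ≥ 1 → Live N M0 → Reach N M0 M → ¬ Deadlock N M
  live⇒deadlock-free nt≥1 live r dead with live (Fin.fromℕ< nt≥1) _ r
  ... | _ , ε , en               = dead _ en
  ... | _ , (x , en , _) ◅ _ , _ = dead x en

  Starved : (Fin (nt N) → Set) → Marking N → Set
  Starved D M = ∀ u → D u → ∃ λ q → M q < pre N q u × (∀ x → 0 < post N x q → D x)

  starved⇒disabled : ∀ {D M u} → Starved D M → D u → ¬ Enabled N M u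
  starved⇒disabled starved Du en with starved _ Du
  ... | q , short , _ = <⇒≱ short (en q)

  -- A starved set cannot fire, so none of its starving places ever gains a token.
  starved-step : ∀ {D M M'} → Step N M M' → Starved D M → Starved D M'
  starved-step {D} {M} {M'} (x , en , fired) starved u Du with starved u Du
  ... | q , short , fedByD = q , ≤-<-trans M'q≤Mq short , fedByD
    where
    noInflow : post N x q ≡ 0
    noInflow = n≤0⇒n≡0 (≮⇒≥ (λ inflow → starved⇒disabled starved (fedByD x inflow) en))
    M'q≤Mq : M' q ≤ M q
    M'q≤Mq = begin
      M' q                          ≡⟨ fired q ⟩
      M q ∸ pre N q x + post N x q  ≡⟨ cong (_+_ (M q ∸ pre N q x)) noInflow ⟩
      M q ∸ pre N q x + 0           ≡⟨ +-identityʳ _ ⟩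
      M q ∸ pre N q x               ≤⟨ m∸n≤m (M q) (pre N q x) ⟩
      M q                           ∎
      where open ≤-Reasoning

  starved-reach : ∀ {D M M'} → Reach N M M' → Starved D M → Starved D M'
  starved-reach ε            = id
  starved-reach (st ◅ steps) = starved-reach steps ∘ starved-step st

  live⇒starved-empty : ∀ {D M0 M} → Live N M0 → Reach N M0 M → Starved D M → ∀ u → ¬ D u
  live⇒starved-empty live r starved u Du with live u _ r
  ... | _ , r' , en = starved⇒disabled (starved-reach r' starved) Du en

  module _ (homogeneous : Homogeneous N) (atMostOneShared : AtMostOneShared N)
           (wmg : WMG≤AfterDeletion N) where

    sharedShortage⇒disabled : ∀ {M M' Y s x y} → StateEq N M' Y M → ¬ Enabled N M y → Y y ≡ 0 →
                              Shared N s → M' s < pre N s x → ¬ Enabled N M' y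
    sharedShortage⇒disabled {M} {M'} {Y} {s} {x} {y} eq ¬en Yy≡0 s-shared short en'
      with disablingPlace ¬en
    ... | q , shortM with q Fin.≟ s
    ...   | yes refl = <⇒≱ (subst (M' q <_) sameWeight short) (en' q)
      where
      sameWeight : pre N q x ≡ pre N q y
      sameWeight = homogeneous q x y (m<n⇒0<n short) (m<n⇒0<n shortM)
    ...   | no q≢s = <⇒≱ (≤-<-trans M'q≤Mq shortM) (en' q)
      where
      q-unshared : ¬ Shared N q
      q-unshared q-shared = q≢s (atMostOneShared q s q-shared s-shared)
      M'q≤Mq : M' q ≤ M q
      M'q≤Mq = stateEq-unconsumed⇒≤ eq (dot-vanish λ z outflow →
                 trans (cong Y (proj₂ (wmg q q-unshared) z y outflow (m<n⇒0<n shortM))) Yy≡0)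

    support-starved : ∀ {M M' Y y} → StateEq N M' Y M → Deadlock N M →
                      (∀ u → 0 < Y u → ¬ Enabled N M' u) → Enabled N M' y →
                      Starved (λ u → 0 < Y u) M'
    support-starved {M} {M'} {Y} {y} eq dead stuck en' u 0<Yu with disablingPlace (stuck u 0<Yu)
    ... | q , short = q , short , fedBySupport
      where
      Yy≡0 : Y y ≡ 0
      Yy≡0 = n≤0⇒n≡0 (≮⇒≥ λ 0<Yy → stuck y 0<Yy en')
      q-unshared : ¬ Shared N q
      q-unshared q-shared = sharedShortage⇒disabled eq (dead y) Yy≡0 q-shared short en'
      fedBySupport : ∀ x → 0 < post N x q → 0 < Y x
      fedBySupport x inflow = n≢0⇒n>0 λ Yx≡0 → <⇒≱ short (begin
        pre N q u            ≤⟨ m≤m*n (pre N q u) (Y u) {{>-nonZero 0<Yu}} ⟩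
        pre N q u * Y u      ≤⟨ term≤dot (pre N q) Y u ⟩
        consumed N Y q       ≤⟨ stateEq-unproduced⇒consumed≤ eq (dot-vanish λ z inflowz →
                                   trans (cong Y (proj₁ (wmg q q-unshared) z x inflowz inflow)) Yx≡0) ⟩
        M' q                 ∎)
        where open ≤-Reasoning

    stuck⇒⊥ : ∀ {M0 M M' Y} → nt N ≥ 1 → Live N M0 → Reach N M0 M' → StateEq N M' Y M →
              Deadlock N M → (∀ u → 0 < Y u → ¬ Enabled N M' u) → ⊥
    stuck⇒⊥ {M' = M'} {Y} nt≥1 live r eq dead stuck = live⇒deadlock-free nt≥1 live r M'-dead
      where
      M'-dead : Deadlock N M'
      M'-dead y en' = dead y λ q →
        ≤-trans (en' q) (stateEq-unconsumed⇒≤ eq (dot-vanish {f = pre N q} λ z _ → Yz≡0 z))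
        where
        Yz≡0 : ∀ z → Y z ≡ 0
        Yz≡0 z = n≤0⇒n≡0 (≮⇒≥ (live⇒starved-empty live r (support-starved eq dead stuck en') z))

    live⇒unreachable-solution : ∀ {M0 M} → nt N ≥ 1 → Live N M0 → Deadlock N M →
                                ∀ n {M' Y} → sum Y < n → Reach N M0 M' → StateEq N M' Y M → ⊥
    live⇒unreachable-solution _ _ _ zero ΣY<0 _ _ = n≮0 ΣY<0
    live⇒unreachable-solution nt≥1 live dead (suc n) {M'} {Y} ΣY<1+n r eq
      with Fin.any? (λ u → (0 ℕ.<? Y u) ×-dec enabled? M' u)
    ... | no none = stuck⇒⊥ nt≥1 live r eq dead (λ u 0<Yu en → none (u , 0<Yu , en))
    ... | yes (u , 0<Yu , en) =
      live⇒unreachable-solution nt≥1 live dead n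
        (subst (_≤ n) (sum-δ-split Y u 0<Yu) (s≤s⁻¹ ΣY<1+n))
        (r ◅◅ fire-step en ◅ ε)
        (stateEq-cancelˡ (stateEq-step (fire-step en)) (stateEq-congʳ (δ-split Y u 0<Yu) eq))

  module _ (M : Marking N) (t : Fin (nt N)) where

    throughput : (Fin (nt N) → ℕ) → Node N → ℕ
    throughput Y (inj₁ p) = produced N Y p
    throughput Y (inj₂ u) = Y u

    BoundedAvoiding : Node N → Set
    BoundedAvoiding x = ∃ λ B → ∀ {M' Y} → StateEq N M Y M' → Y t ≡ 0 → throughput Y x ≤ B

    boundedAvoiding-arc : WMG≤AfterDeletion N → ∀ {x y} → ArcIn N (KeptAfterDeletion N) x y →
                          BoundedAvoiding x → BoundedAvoiding y
    boundedAvoiding-arc wmg {inj₂ v} {inj₁ p} (_ , p-unshared , v→p) (B , bound) =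
      post N v p * B , λ {_} {Y} eq avoid → begin
        produced N Y p       ≡⟨ dot-single Y (λ x x→p → proj₁ (wmg p p-unshared) x v x→p v→p) ⟩
        post N v p * Y v     ≤⟨ *-monoʳ-≤ (post N v p) (bound eq avoid) ⟩
        post N v p * B       ∎
      where open ≤-Reasoning
    boundedAvoiding-arc wmg {inj₁ p} {inj₂ u} (_ , _ , p→u) (B , bound) =
      M p + B , λ {M'} {Y} eq avoid → begin
        Y u                     ≤⟨ m≤n*m (Y u) (pre N p u) {{>-nonZero p→u}} ⟩
        pre N p u * Y u         ≤⟨ term≤dot (pre N p) Y u ⟩
        consumed N Y p          ≤⟨ m≤n+m _ (M' p) ⟩
        M' p + consumed N Y p   ≡⟨ eq p ⟩
        M p + produced N Y p    ≤⟨ +-monoʳ-≤ (M p) (bound eq avoid) ⟩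
        M p + B                 ∎
      where open ≤-Reasoning
    boundedAvoiding-arc wmg {inj₁ _} {inj₁ _} (_ , _ , ())
    boundedAvoiding-arc wmg {inj₂ _} {inj₂ _} (_ , _ , ())

    boundedAvoiding-path : WMG≤AfterDeletion N → ∀ {x y} → Star (ArcIn N (KeptAfterDeletion N)) x y →
                           BoundedAvoiding x → BoundedAvoiding y
    boundedAvoiding-path wmg ε            = id
    boundedAvoiding-path wmg (arc ◅ arcs) = boundedAvoiding-path wmg arcs ∘ boundedAvoiding-arc wmg arc

    avoiding-total-bound : WMG≤AfterDeletion N → StronglyConnectedAfterDeletion N →
                           ∃ λ B → ∀ {M' Y} → StateEq N M Y M' → Y t ≡ 0 → sum Y ≤ B
    avoiding-total-bound wmg scd =
      sum (proj₁ ∘ bounded) , λ eq avoid → sum-mono-≤ (λ u → proj₂ (bounded u) eq avoid)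
      where
      bounded : ∀ u → BoundedAvoiding (inj₂ u)
      bounded u = boundedAvoiding-path wmg (scd (inj₂ t) (inj₂ u) tt tt) (0 , λ _ avoid → ≤-reflexive avoid)

    eventually-enabled : (B : ℕ) → (∀ {M' Y} → StateEq N M Y M' → Y t ≡ 0 → sum Y ≤ B) →
                         (∀ {M'} → Reach N M M' → ¬ Deadlock N M') →
                         ∃ λ M' → Reach N M M' × Enabled N M' t
    eventually-enabled B bound deadlock-free =
      search (suc B) ε stateEq-refl refl (<-≤-trans (n<1+n B) (m≤m+n (suc B) _))
      where
      search : ∀ k {M' Y} → Reach N M M' → StateEq N M Y M' → Y t ≡ 0 → B < k + sum Y →
               ∃ λ M'' → Reach N M M'' × Enabled N M'' t
      search zero r eq avoid over = contradiction (bound eq avoid) (<⇒≱ over)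
      search (suc k) {M'} {Y} r eq avoid over with Fin.any? (enabled? M')
      ... | no none = ⊥-elim (deadlock-free r (λ x en → none (x , en)))
      ... | yes (x , en) with x Fin.≟ t
      ...   | yes refl = M' , r , en
      ...   | no x≢t   = search k (r ◅◅ fire-step en ◅ ε) (stateEq-trans eq (stateEq-step (fire-step en)))
                                (trans (cong (_+ δ x t) avoid) (δ-≢ x≢t)) (subst (B <_) longer over)
        where
        longer : suc k + sum Y ≡ k + sum (λ s → Y s + δ x s)
        longer = begin
          suc k + sum Y                        ≡⟨ +-suc k (sum Y) ⟨
          k + suc (sum Y)                      ≡⟨ cong (_+_ k) (+-comm 1 (sum Y)) ⟩
          k + (sum Y + 1)                      ≡⟨ cong (λ c → k + (sum Y + c)) (sum-δ x) ⟨
          k + (sum Y + sum (δ x))              ≡⟨ cong (_+_ k) (∑-distrib-+ Y (δ x)) ⟨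
          k + sum (λ s → Y s + δ x s)          ∎
          where open ≡-Reasoning

  reachable-deadlock⇒solution : ∀ {M0 M} → Reach N M0 M → Deadlock N M → DeadlockSolution N M0
  reachable-deadlock⇒solution r dead with stateEq-reach r
  ... | Y , eq = _ , Y , Equivalence.to (stateEq⇔incidence Y) eq , dead

  live⇒noDeadlockSolution : ∀ {M0} → nt N ≥ 1 → H1S-WMG≤ N → Live N M0 → ¬ DeadlockSolution N M0
  live⇒noDeadlockSolution nt≥1 ((homogeneous , atMostOneShared) , wmg) live (_ , Y , eq , dead) =
    live⇒unreachable-solution homogeneous atMostOneShared wmg nt≥1 live dead
      (suc (sum Y)) (n<1+n (sum Y)) ε (Equivalence.from (stateEq⇔incidence Y) eq)

  noDeadlockSolution⇒live : ∀ {M0} → WMG≤AfterDeletion N → StronglyConnectedAfterDeletion N →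
                            ¬ DeadlockSolution N M0 → Live N M0
  noDeadlockSolution⇒live wmg scd noSolution t M r with avoiding-total-bound M t wmg scd
  ... | B , bound = eventually-enabled M t B bound
                      (λ r' dead → noSolution (reachable-deadlock⇒solution (r ◅◅ r') dead))

mainTheorem7 : (N : Net) (M0 : Marking N) →
    np N ≥ 1 → nt N ≥ 1 →
    StronglyConnected N → H1S-WMG≤ N → StronglyConnectedAfterDeletion N →
    Live N M0 ⇔ (¬ DeadlockSolution N M0)
mainTheorem7 N M0 _ nt≥1 _ h1s-wmg scd =
  mk⇔ (live⇒noDeadlockSolution nt≥1 h1s-wmg) (noDeadlockSolution⇒live (proj₂ h1s-wmg) scd)
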